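{- Let $q\ge0$ be an integer and let $\mathcal D$ be a design with $v$ pools on $n$ objects, with dual $\hat{\mathcal D}=(B_1,\dots,B_n)$. Then $\hat{\mathcal D}\in\mathcal S^v_{2,q}$ if and only if, for each $B\in\hat{\mathcal D}$, the family of sets that are private in $\hat{\mathcal D}$ is a $(2,q)$-cover of $B$.
   Context: A design with $v$ pools on $n$ objects is a list $\mathcal D=(A_1,\dots,A_v)$ of subsets of $\{1,\dots,n\}$; its dual is $\hat{\mathcal D}=(B_1,\dots,B_n)$ with $B_i=\{j\in\{1,\dots,v\}: i\in A_j\}$. For $A\subseteq\{1,\dots,n\}$ let $\phi(A)=\bigcup_{i\in A}B_i$ ($\phi(\emptyset)=\emptyset$). For integers $p,q\ge0$, $\mathcal D$ is a $(p,q)$-solution if $|\phi(A)\triangle\phi(A')|>q$ for all $A,A'\subseteq\{1,\dots,n\}$ with $A\ne A'$ and $|A|\le p$ ($\triangle$ = symmetric difference); $\mathcal S^v_{p,q}$ is the set of duals of $(p,q)$-solutions with $v$ pools. Let $\mathcal X_v$ be the set of all subsets of $\{1,\dots,v\}$. A set $b\in\mathcal X_v$ is private in $\hat{\mathcal D}$ if there is exactly one member $B$ of $\hat{\mathcal D}$ with $b\subseteq B$. For $B\in\mathcal X_v$ with $|B|>q$, a family $\mathcal F\subseteq\mathcal X_v$ is a $(2,q)$-cover of $B$ if (1) whenever $b\in\mathcal F$ and $b\subset b'\subseteq B$, then $b'\in\mathcal F$; and (2) for every $b\subseteq B$ with $|B\setminus b|\le q$, and every partition of $b$ into two disjoint (possibly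 empty) parts, at least one of the two parts belongs to $\mathcal F$. (Being a $(2,q)$-cover of $B$ presupposes $|B|>q$.) -}

module Defs where

open import Data.Nat using (ℕ; zero; suc; _≤_; _<_)
open import Data.Fin using (Fin)
import Data.Fin as F
open import Data.Fin.Subset
open import Data.Vec using (Vec; []; _∷_; tabulate)
open import Data.Product using (Σ; _×_)
open import Data.Sum using (_⊎_)
open import Relation.Binary.PropositionalEquality using (_≡_; _≢_)

Design : ℕ → ℕ → Set
Design v n = Fin v → Subset n

dual : ∀ {v n} → Design v n → Fin n → Subset v
dual D i = tabulate (λ j → Data.Vec.lookup (D j) i)

unionOver : ∀ {n v} → (Fin n → Subset v) → Subset n → Subset v
unionOver {zero}  f []            = ⊥
unionOver {suc n} f (outside ∷ A) = unionOver (λ i → f (F.suc i)) A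
unionOver {suc n} f (inside  ∷ A) = f F.zero ∪ unionOver (λ i → f (F.suc i)) A

φ : ∀ {n v} → (Fin n → Subset v) → Subset n → Subset v
φ B A = unionOver B A

_△_ : ∀ {v} → Subset v → Subset v → Subset v
X △ Y = (X ─ Y) ∪ (Y ─ X)

IsSolution : ∀ {v n} → ℕ → ℕ → Design v n → Set
IsSolution {v} {n} p q D =
  (A A′ : Subset n) → A ≢ A′ → ∣ A ∣ ≤ p → q < ∣ φ (dual D) A △ φ (dual D) A′ ∣

Private : ∀ {n v} → (Fin n → Subset v) → Subset v → Set
Private {n} B b = Σ (Fin n) λ i → (b ⊆ B i) × ((j : Fin n) → b ⊆ B j → j ≡ i)

Is2qCover : ∀ {v} → ℕ → (Subset v → Set) → Subset v → Set
Is2qCover {v} q 𝓕 B =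
  (q < ∣ B ∣)
  × ((b b′ : Subset v) → 𝓕 b → b ⊂ b′ → b′ ⊆ B → 𝓕 b′)
  × ((b : Subset v) → b ⊆ B → ∣ B ─ b ∣ ≤ q →
     (b₁ b₂ : Subset v) → Empty (b₁ ∩ b₂) → b₁ ∪ b₂ ≡ b → 𝓕 b₁ ⊎ 𝓕 b₂)

-- Both sides are equivalent to a q-error-tolerant 2-disjunctness: |B i ∖ φ(A)| > q whenever
-- i ∉ A and |A| ≤ 2. A solution gives it by comparing A with A ∪ {i}; conversely, distinct
-- A, A′ differ in some i lying in one of them but not in the other, that other has at most
-- two elements, and B i ∖ φ(other) lies inside the symmetric difference. On the cover side,
-- a split of a large b ⊆ B i into two non-private parts puts the parts inside some B j, B k
-- with j, k ≠ i, so b ⊆ φ{j,k}; conversely B i ∩ (B j ∪ B k) splits disjointly as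
-- (B i ∩ B j) ∪ (B i ∩ B k ∖ B j), and neither part can be private.
module Submission where

open import Defs
open import Data.Nat using (ℕ; suc; _≤_; _<_; _+_; z≤n; s≤s)
open import Data.Nat.Properties
  using (≤-trans; ≤-pred; <-≤-trans; ≤-<-trans; <⇒≱; ≰⇒>; <-irrefl; +-monoʳ-≤; +-suc)
open import Data.Fin using (Fin)
open import Data.Fin.Properties using (any?; _≟_)
open import Data.Fin.Subset
open import Data.Fin.Subset.Properties
open import Data.Vec using ([]; _∷_)
open import Data.Vec.Base using (here; there)
open import Data.Product using (_×_; _,_; proj₂; ∃)
open import Data.Sum using (_⊎_; inj₁; inj₂; [_,_])
open import Data.Empty using (⊥-elim)
open import Relation.Nullary using (¬_; yes; no)
open import Relation.Nullary.Decidable using (_×-dec_; ¬?; decidable-stable)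
open import Relation.Binary.PropositionalEquality using (_≡_; _≢_; refl; sym; trans; subst; cong₂)
open import Function using (_∘_)
open import Function.Bundles using (_⇔_; mk⇔)

private
  variable
    n v : ℕ
    x y : Fin n
    p q : Subset n

x∈p─q⁻ : ∀ (p q : Subset n) {x} → x ∈ p ─ q → x ∈ p × x ∉ q
x∈p─q⁻ (_ ∷ p) (inside  ∷ q) {Fin.zero} ()
x∈p─q⁻ (_ ∷ p) (outside ∷ q) {Fin.zero} here = here , λ ()
x∈p─q⁻ (_ ∷ p) (_ ∷ q) {Fin.suc x} (there h) with x∈p─q⁻ p q h
... | x∈p , x∉q = there x∈p , x∉q ∘ drop-there

p─q⊆p─r : ∀ (p : Subset n) {q r} → r ⊆ q → p ─ q ⊆ p ─ r
p─q⊆p─r p {q} r⊆q h with x∈p─q⁻ p q h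
... | x∈p , x∉q = x∈p∧x∉q⇒x∈p─q x∈p (x∉q ∘ r⊆q)

p⊆q⇒p─r⊆q─r : ∀ {p q : Subset n} r → p ⊆ q → p ─ r ⊆ q ─ r
p⊆q⇒p─r⊆q─r {p = p} r p⊆q h with x∈p─q⁻ p r h
... | x∈p , x∉r = x∈p∧x∉q⇒x∈p─q (p⊆q x∈p) x∉r

x∉⁅y⁆∪⁅z⁆ : ∀ {x y z : Fin n} → x ≢ y → x ≢ z → x ∉ ⁅ y ⁆ ∪ ⁅ z ⁆
x∉⁅y⁆∪⁅z⁆ {y = y} {z} x≢y x≢z h with x∈p∪q⁻ ⁅ y ⁆ ⁅ z ⁆ h
... | inj₁ x∈⁅y⁆ = x≢y (x∈⁅y⁆⇒x≡y y x∈⁅y⁆)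
... | inj₂ x∈⁅z⁆ = x≢z (x∈⁅y⁆⇒x≡y z x∈⁅z⁆)

∣p∪q∣≤∣p∣+∣q∣ : ∀ (p q : Subset n) → ∣ p ∪ q ∣ ≤ ∣ p ∣ + ∣ q ∣
∣p∪q∣≤∣p∣+∣q∣ []            []            = z≤n
∣p∪q∣≤∣p∣+∣q∣ (inside  ∷ p) (s ∷ q)       =
  s≤s (≤-trans (∣p∪q∣≤∣p∣+∣q∣ p q) (+-monoʳ-≤ ∣ p ∣ (∣p∣≤∣x∷p∣ s q)))
∣p∪q∣≤∣p∣+∣q∣ (outside ∷ p) (inside  ∷ q) =
  subst (suc ∣ p ∪ q ∣ ≤_) (sym (+-suc ∣ p ∣ ∣ q ∣)) (s≤s (∣p∪q∣≤∣p∣+∣q∣ p q))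
∣p∪q∣≤∣p∣+∣q∣ (outside ∷ p) (outside ∷ q) = ∣p∪q∣≤∣p∣+∣q∣ p q

∣⁅x⁆∪⁅y⁆∣≤2 : ∀ (x y : Fin n) → ∣ ⁅ x ⁆ ∪ ⁅ y ⁆ ∣ ≤ 2
∣⁅x⁆∪⁅y⁆∣≤2 x y =
  subst (∣ ⁅ x ⁆ ∪ ⁅ y ⁆ ∣ ≤_) (cong₂ _+_ (∣⁅x⁆∣≡1 x) (∣⁅x⁆∣≡1 y)) (∣p∪q∣≤∣p∣+∣q∣ ⁅ x ⁆ ⁅ y ⁆)

∣p∣≤1⇒x≡y : ∣ p ∣ ≤ 1 → x ∈ p → y ∈ p → x ≡ y
∣p∣≤1⇒x≡y {x = x} {y = y} ∣p∣≤1 x∈p y∈p with x ≟ y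
... | yes x≡y = x≡y
... | no  x≢y = ⊥-elim (<-irrefl refl (<-≤-trans 0<∣p-x∣ (≤-pred (<-≤-trans (x∈p⇒∣p-x∣<∣p∣ x∈p) ∣p∣≤1))))
  where
  0<∣p-x∣ = ≤-<-trans z≤n (x∈p⇒∣p-x∣<∣p∣ (x∈p∧x≢y⇒x∈p-y y∈p (x≢y ∘ sym)))

∣p∣≤2⇒⊆pair : ∣ p ∣ ≤ 2 → x ∈ p → ∃ λ y → y ∈ p × (∀ {z} → z ∈ p → z ≡ x ⊎ z ≡ y)
∣p∣≤2⇒⊆pair {p = p} {x = x} ∣p∣≤2 x∈p with nonempty? (p - x)
... | no  p-x-empty = x , x∈p , only-x
  where
  only-x : ∀ {z} → z ∈ p → z ≡ x ⊎ z ≡ x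
  only-x {z} z∈p with z ≟ x
  ... | yes z≡x = inj₁ z≡x
  ... | no  z≢x = ⊥-elim (p-x-empty (z , x∈p∧x≢y⇒x∈p-y z∈p z≢x))
... | yes (y , y∈p-x) = y , p─q⊆p p ⁅ x ⁆ y∈p-x , x-or-y
  where
  x-or-y : ∀ {z} → z ∈ p → z ≡ x ⊎ z ≡ y
  x-or-y {z} z∈p with z ≟ x
  ... | yes z≡x = inj₁ z≡x
  ... | no  z≢x = inj₂ (∣p∣≤1⇒x≡y ∣p-x∣≤1 (x∈p∧x≢y⇒x∈p-y z∈p z≢x) y∈p-x)
    where
    ∣p-x∣≤1 = ≤-pred (<-≤-trans (x∈p⇒∣p-x∣<∣p∣ x∈p) ∣p∣≤2)

⊈⇒∃∉ : ¬ p ⊆ q → ∃ λ x → x ∈ p × x ∉ q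
⊈⇒∃∉ {p = p} {q = q} p⊈q with any? (λ x → (x ∈? p) ×-dec ¬? (x ∈? q))
... | yes witness = witness
... | no  ¬witness =
  ⊥-elim (p⊈q λ {x} x∈p → decidable-stable (x ∈? q) (λ x∉q → ¬witness (x , x∈p , x∉q)))

∈-unionOver⁺ : ∀ (f : Fin n → Subset v) (A : Subset n) {i} {x} →
               i ∈ A → x ∈ f i → x ∈ unionOver f A
∈-unionOver⁺ f (inside  ∷ A) here      h = x∈p∪q⁺ (inj₁ h)
∈-unionOver⁺ f (outside ∷ A) (there i) h = ∈-unionOver⁺ (f ∘ Fin.suc) A i h
∈-unionOver⁺ f (inside  ∷ A) (there i) h = x∈p∪q⁺ (inj₂ (∈-unionOver⁺ (f ∘ Fin.suc) A i h))

∈-unionOver⁻ : ∀ (f : Fin n → Subset v) (A : Subset n) {x} →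
               x ∈ unionOver f A → ∃ λ i → i ∈ A × x ∈ f i
∈-unionOver⁻ f []            h = ⊥-elim (∉⊥ h)
∈-unionOver⁻ f (outside ∷ A) h with ∈-unionOver⁻ (f ∘ Fin.suc) A h
... | i , i∈A , x∈fi = Fin.suc i , there i∈A , x∈fi
∈-unionOver⁻ f (inside  ∷ A) h with x∈p∪q⁻ (f Fin.zero) _ h
... | inj₁ x∈f0 = Fin.zero , here , x∈f0
... | inj₂ h′ with ∈-unionOver⁻ (f ∘ Fin.suc) A h′
... | i , i∈A , x∈fi = Fin.suc i , there i∈A , x∈fi

p─r⊆unionOver─r : ∀ (f : Fin n → Subset v) {A i} r → i ∈ A → f i ─ r ⊆ unionOver f A ─ r
p─r⊆unionOver─r f {A} r i∈A = p⊆q⇒p─r⊆q─r r (∈-unionOver⁺ f A i∈A)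

module _ {n v : ℕ} (B : Fin n → Subset v) where

  private-upward : ∀ {b b′ i} → Private B b → b ⊆ b′ → b′ ⊆ B i → Private B b′
  private-upward {i = i} (_ , _ , unique) b⊆b′ b′⊆Bi =
    i , b′⊆Bi , λ j b′⊆Bj → trans (unique j (⊆-trans b⊆b′ b′⊆Bj)) (sym (unique i (⊆-trans b⊆b′ b′⊆Bi)))

  shared⇒¬private : ∀ {b i j} → b ⊆ B i → b ⊆ B j → i ≢ j → ¬ Private B b
  shared⇒¬private {i = i} {j} b⊆Bi b⊆Bj i≢j (_ , _ , unique) = i≢j (trans (unique i b⊆Bi) (sym (unique j b⊆Bj)))

  private-or-shared : ∀ {b i} → b ⊆ B i → Private B b ⊎ ∃ λ j → j ≢ i × b ⊆ B j
  private-or-shared {b} {i} b⊆Bi with any? (λ j → ¬? (j ≟ i) ×-dec (b ⊆? B j))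
  ... | yes shared = inj₂ shared
  ... | no  ¬shared = inj₁ (i , b⊆Bi , only-i)
    where
    only-i : (j : Fin n) → b ⊆ B j → j ≡ i
    only-i j b⊆Bj = decidable-stable (j ≟ i) (λ j≢i → ¬shared (j , j≢i , b⊆Bj))

  Is2qDisjunct : ℕ → Set
  Is2qDisjunct q = ∀ {i A} → i ∉ A → ∣ A ∣ ≤ 2 → q < ∣ B i ─ φ B A ∣

  disjunct⇒cover : ∀ {q} → Is2qDisjunct q → ∀ i → Is2qCover q (Private B) (B i)
  disjunct⇒cover {q} disjunct i = q<∣Bi∣ , upward , split
    where
    q<∣Bi∣ : q < ∣ B i ∣
    q<∣Bi∣ = <-≤-trans (disjunct (∉⊥ {x = i}) (subst (_≤ 2) (sym (∣⊥∣≡0 n)) z≤n))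
                       (∣p─q∣≤∣p∣ (B i) (φ B ⊥))

    upward : ∀ b b′ → Private B b → b ⊂ b′ → b′ ⊆ B i → Private B b′
    upward _ _ priv (b⊆b′ , _) = private-upward priv b⊆b′

    split : (b : Subset v) → b ⊆ B i → ∣ B i ─ b ∣ ≤ q →
            (b₁ b₂ : Subset v) → Empty (b₁ ∩ b₂) → b₁ ∪ b₂ ≡ b → Private B b₁ ⊎ Private B b₂
    split _ b⊆Bi ∣Bi─b∣≤q b₁ b₂ _ refl
      with private-or-shared (λ h → b⊆Bi (p⊆p∪q b₂ h))
         | private-or-shared (λ h → b⊆Bi (q⊆p∪q b₁ b₂ h))
    ... | inj₁ priv | _         = inj₁ priv
    ... | inj₂ _    | inj₁ priv = inj₂ priv
    ... | inj₂ (j , j≢i , b₁⊆Bj) | inj₂ (k , k≢i , b₂⊆Bk) =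
      ⊥-elim (<⇒≱ (disjunct (x∉⁅y⁆∪⁅z⁆ (j≢i ∘ sym) (k≢i ∘ sym)) (∣⁅x⁆∪⁅y⁆∣≤2 j k))
                  (≤-trans (p⊆q⇒∣p∣≤∣q∣ (p─q⊆p─r (B i) b⊆φjk)) ∣Bi─b∣≤q))
      where
      b⊆φjk : b₁ ∪ b₂ ⊆ φ B (⁅ j ⁆ ∪ ⁅ k ⁆)
      b⊆φjk h with x∈p∪q⁻ b₁ b₂ h
      ... | inj₁ h₁ = ∈-unionOver⁺ B _ (x∈p∪q⁺ (inj₁ (x∈⁅x⁆ j))) (b₁⊆Bj h₁)
      ... | inj₂ h₂ = ∈-unionOver⁺ B _ (x∈p∪q⁺ (inj₂ (x∈⁅x⁆ k))) (b₂⊆Bk h₂)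

  cover⇒disjunct : ∀ {q} → (∀ i → Is2qCover q (Private B) (B i)) → Is2qDisjunct q
  cover⇒disjunct cover {i} {A} i∉A ∣A∣≤2 with cover i | nonempty? A
  ... | q<∣Bi∣ , _ , _ | no A-empty = <-≤-trans q<∣Bi∣ (p⊆q⇒∣p∣≤∣q∣ Bi⊆Bi─φA)
    where
    Bi⊆Bi─φA : B i ⊆ B i ─ φ B A
    Bi⊆Bi─φA h = x∈p∧x∉q⇒x∈p─q h λ h′ → let (l , l∈A , _) = ∈-unionOver⁻ B A h′ in A-empty (l , l∈A)
  ... | _ , _ , split | yes (j , j∈A) with ∣p∣≤2⇒⊆pair ∣A∣≤2 j∈A
  ... | k , k∈A , j-or-k = ≰⇒> λ ∣Bi─φA∣≤q →
    [ shared⇒¬private (p∩q⊆p (B i) (B j)) (p∩q⊆q (B i) (B j)) (≢-member j∈A)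
    , shared⇒¬private (λ h → p∩q⊆p (B i) (B k) (p─q⊆p _ (B j) h))
                      (λ h → p∩q⊆q (B i) (B k) (p─q⊆p _ (B j) h)) (≢-member k∈A)
    ] (split (b₁ ∪ b₂) b⊆Bi (≤-trans (p⊆q⇒∣p∣≤∣q∣ Bi─b⊆Bi─φA) ∣Bi─φA∣≤q) b₁ b₂ disjoint refl)
    where
    b₁ b₂ : Subset v
    b₁ = B i ∩ B j
    b₂ = (B i ∩ B k) ─ B j

    ≢-member : ∀ {l} → l ∈ A → i ≢ l
    ≢-member l∈A i≡l = i∉A (subst (_∈ A) (sym i≡l) l∈A)

    b⊆Bi : b₁ ∪ b₂ ⊆ B i
    b⊆Bi h with x∈p∪q⁻ b₁ b₂ h
    ... | inj₁ h₁ = p∩q⊆p (B i) (B j) h₁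
    ... | inj₂ h₂ = p∩q⊆p (B i) (B k) (p─q⊆p _ (B j) h₂)

    disjoint : Empty (b₁ ∩ b₂)
    disjoint (_ , h) with x∈p∩q⁻ b₁ b₂ h
    ... | h₁ , h₂ = proj₂ (x∈p─q⁻ (B i ∩ B k) (B j) h₂) (p∩q⊆q (B i) (B j) h₁)

    Bi─b⊆Bi─φA : B i ─ (b₁ ∪ b₂) ⊆ B i ─ φ B A
    Bi─b⊆Bi─φA h with x∈p─q⁻ (B i) (b₁ ∪ b₂) h
    ... | x∈Bi , x∉b = x∈p∧x∉q⇒x∈p─q x∈Bi x∉φA
      where
      x∉Bj = λ x∈Bj → x∉b (x∈p∪q⁺ (inj₁ (x∈p∩q⁺ (x∈Bi , x∈Bj))))
      x∉Bk = λ x∈Bk → x∉b (x∈p∪q⁺ (inj₂ (x∈p∧x∉q⇒x∈p─q (x∈p∩q⁺ (x∈Bi , x∈Bk)) x∉Bj)))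
      x∉φA = λ x∈φA → let (l , l∈A , x∈Bl) = ∈-unionOver⁻ B A x∈φA in
        [ (λ l≡j → x∉Bj (subst (λ m → _ ∈ B m) l≡j x∈Bl))
        , (λ l≡k → x∉Bk (subst (λ m → _ ∈ B m) l≡k x∈Bl)) ] (j-or-k l∈A)

module _ {v n q : ℕ} (D : Design v n) where

  private
    B = dual D

  solution⇒disjunct : IsSolution 2 q D → Is2qDisjunct B q
  solution⇒disjunct solution {i} {A} i∉A ∣A∣≤2 =
    <-≤-trans (solution A A′ A≢A′ ∣A∣≤2) (p⊆q⇒∣p∣≤∣q∣ φA△φA′⊆Bi─φA)
    where
    A′ = A ∪ ⁅ i ⁆

    A≢A′ : A ≢ A′
    A≢A′ A≡A′ = i∉A (subst (i ∈_) (sym A≡A′) (x∈p∪q⁺ (inj₂ (x∈⁅x⁆ i))))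

    φA⊆φA′ : φ B A ⊆ φ B A′
    φA⊆φA′ h = let (l , l∈A , x∈Bl) = ∈-unionOver⁻ B A h in
      ∈-unionOver⁺ B A′ (x∈p∪q⁺ (inj₁ l∈A)) x∈Bl

    φA△φA′⊆Bi─φA : φ B A △ φ B A′ ⊆ B i ─ φ B A
    φA△φA′⊆Bi─φA h with x∈p∪q⁻ (φ B A ─ φ B A′) (φ B A′ ─ φ B A) h
    ... | inj₁ h₁ = let (x∈φA , x∉φA′) = x∈p─q⁻ (φ B A) (φ B A′) h₁ in ⊥-elim (x∉φA′ (φA⊆φA′ x∈φA))
    ... | inj₂ h₂ with x∈p─q⁻ (φ B A′) (φ B A) h₂
    ...   | x∈φA′ , x∉φA with ∈-unionOver⁻ B A′ x∈φA′
    ...     | l , l∈A′ , x∈Bl with x∈p∪q⁻ A ⁅ i ⁆ l∈A′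
    ...       | inj₁ l∈A  = ⊥-elim (x∉φA (∈-unionOver⁺ B A l∈A x∈Bl))
    ...       | inj₂ l∈⁅i⁆ = x∈p∧x∉q⇒x∈p─q (subst (λ m → _ ∈ B m) (x∈⁅y⁆⇒x≡y i l∈⁅i⁆) x∈Bl) x∉φA

  disjunct⇒solution : Is2qDisjunct B q → IsSolution 2 q D
  disjunct⇒solution disjunct A A′ A≢A′ ∣A∣≤2 with A′ ⊆? A
  ... | no A′⊈A =
    let (i , i∈A′ , i∉A) = ⊈⇒∃∉ A′⊈A in
    <-≤-trans (disjunct i∉A ∣A∣≤2)
              (p⊆q⇒∣p∣≤∣q∣ (λ h → q⊆p∪q (φ B A ─ φ B A′) _ (p─r⊆unionOver─r B (φ B A) i∈A′ h)))
  ... | yes A′⊆A =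
    let (i , i∈A , i∉A′) = ⊈⇒∃∉ (λ A⊆A′ → A≢A′ (⊆-antisym A⊆A′ A′⊆A)) in
    <-≤-trans (disjunct i∉A′ (≤-trans (p⊆q⇒∣p∣≤∣q∣ A′⊆A) ∣A∣≤2))
              (p⊆q⇒∣p∣≤∣q∣ (λ h → p⊆p∪q (φ B A′ ─ φ B A) (p─r⊆unionOver─r B (φ B A′) i∈A h)))

lemma1 : (v n q : ℕ) (D : Design v n) →
    IsSolution 2 q D ⇔ ((i : Fin n) → Is2qCover q (Private (dual D)) (dual D i))
lemma1 v n q D = mk⇔
  (disjunct⇒cover (dual D) ∘ solution⇒disjunct D)
  (disjunct⇒solution D ∘ cover⇒disjunct (dual D))
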